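{- Let $\Gamma$ be a finite cyclically orientable graph and $j$ a vertex of $\Gamma$ with at least one edge through it. Then there is an edge through $j$ that belongs to at most one chordless cycle of $\Gamma$.
   Context: Graphs are finite, simple, undirected. A chordless cycle is an induced subgraph isomorphic to a cycle of length at least $3$. A graph is cyclically orientable if it admits an orientation of its edges in which every chordless cycle is cyclically oriented (its edges form a directed cycle). -}

module Defs where

open import Data.Nat using (ℕ; suc)
open import Data.Nat.DivMod using (_mod_)
open import Data.Fin using (Fin; toℕ)
open import Data.Bool using (Bool; true; false; T)
open import Data.Product using (Σ; _×_; ∃; ∃-syntax; _,_)
open import Data.Sum using (_⊎_)
open import Relation.Nullary using (¬_)
open import Relation.Binary.PropositionalEquality using (_≡_)
open import Function.Definitions using (Injective)
open import Function.Bundles using (_⇔_)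

record Graph (n : ℕ) : Set where
  field
    adj    : Fin n → Fin n → Bool
    sym    : ∀ x y → adj x y ≡ adj y x
    irrefl : ∀ x → adj x x ≡ false
open Graph public

next : ∀ {m} → Fin (suc m) → Fin (suc m)
next {m} i = suc (toℕ i) mod (suc m)

Consec : ∀ {m} → Fin (suc m) → Fin (suc m) → Set
Consec i j = (j ≡ next i) ⊎ (i ≡ next j)

-- A chordless cycle: an induced subgraph isomorphic to the cycle C_k, k ≥ 3.
-- Given by an injective listing v of its k = m + 3 vertices around the cycle,
-- such that two listed vertices are adjacent in G iff they are cyclically
-- consecutive (so the induced subgraph on the image is exactly C_k).
record ChordlessCycle {n : ℕ} (G : Graph n) : Set where
  field
    m        : ℕ
    vert     : Fin (suc (suc (suc m))) → Fin n
    inj      : Injective _≡_ _≡_ vert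
    induced  : ∀ i j → T (adj G (vert i) (vert j)) ⇔ Consec i j
open ChordlessCycle public

-- The cycle, as a subgraph, is determined by its vertex set (it is induced).
OnCycle : ∀ {n} {G : Graph n} → ChordlessCycle G → Fin n → Set
OnCycle C x = ∃[ i ] (vert C i ≡ x)

SameCycle : ∀ {n} {G : Graph n} → ChordlessCycle G → ChordlessCycle G → Set
SameCycle C D = ∀ x → OnCycle C x ⇔ OnCycle D x

EdgeOf : ∀ {n} {G : Graph n} → ChordlessCycle G → Fin n → Fin n → Set
EdgeOf C a b = ∃[ i ] ((vert C i ≡ a × vert C (next i) ≡ b)
                     ⊎ (vert C i ≡ b × vert C (next i) ≡ a))

record Orientation {n : ℕ} (G : Graph n) : Set where
  field
    arc       : Fin n → Fin n → Bool
    arc-edge  : ∀ x y → T (arc x y) → T (adj G x y)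
    edge-arc  : ∀ x y → T (adj G x y) →
                (T (arc x y) × ¬ T (arc y x)) ⊎ (T (arc y x) × ¬ T (arc x y))
open Orientation public

CyclicallyOriented : ∀ {n} {G : Graph n} → Orientation G → ChordlessCycle G → Set
CyclicallyOriented O C =
  (∀ i → T (arc O (vert C i) (vert C (next i))))
  ⊎ (∀ i → T (arc O (vert C (next i)) (vert C i)))

CyclicallyOrientable : ∀ {n} → Graph n → Set
CyclicallyOrientable G =
  Σ (Orientation G) λ O → ∀ (C : ChordlessCycle G) → CyclicallyOriented O C

-- Call neighbours x ≠ y of j partners if some walk from x
-- to y meets the closed neighbourhood of j only in x and y. Shortening it to an induced path and adding
-- j gives a chordless cycle, whose orientation makes the arcs between j and x, y point in opposite
-- directions; so neighbours on the same side of j are never partners. Hence two such induced paths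
-- between the same partners coincide (at a first divergence both would leave the common vertex in the
-- same direction), and each partner c of k spans exactly one chordless cycle through jk and jc.
-- It remains to find a neighbour k with at most one partner. For partners c, d and d, e with c ≠ e,
-- every vertex reachable from e avoiding the closed neighbourhood of d is reachable from d avoiding
-- that of c, while d is only reachable in the latter sense. These reachable sets thus strictly shrink
-- along chains of partners that never turn back, so such a chain ends at a neighbour with at most one
-- partner.

module Submission where

open import Defs hiding (sym)
open import Data.Nat
  using (ℕ; zero; suc; pred; _+_; _*_; _∸_; _%_; _≤_; _<_; _≤′_; ≤′-refl; ≤′-step; z≤n; s≤s; s≤s⁻¹; NonZero)
open import Data.Nat.Properties
  using (*-comm; +-assoc; +-cancelˡ-≡; +-comm; +-identityʳ; +-monoʳ-<; +-monoʳ-≤; +-suc; +-∸-assoc; 0≢1+n; 1+n≢0;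
         <-asym; <-trans; <-≤-trans; <⇒≢; <⇒≤; <⇒≱; m+[n∸m]≡n; m<n⇒m<1+n; m∸[m∸n]≡n; m∸n+n≡m; m∸n≤m; m≤n+m;
         m≤n⇒m<n∨m≡n; m≤n⇒m≤1+n; n<1+n; n∸n≡0; n≤0⇒n≡0; n≤1+n; suc-injective; suc-pred; ∸-cancelˡ-≡; ∸-monoʳ-<;
         ≤-antisym; ≤-refl; ≤-reflexive; ≤-trans; ≤′⇒≤; ≤⇒≤′; ≤∧≢⇒<)
open import Data.Nat.DivMod
  using (_mod_; %-distribˡ-+; %-remove-+ˡ; m%n%n≡m%n; [m+kn]%n≡m%n; [m+n]%n≡m%n; m%n<n; m<n⇒m%n≡m; n%n≡0)
open import Data.Nat.Divisibility using (∣-refl)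
open import Data.Fin using (Fin; toℕ; fromℕ<)
open import Data.Fin.Properties using (any?; _≟_; toℕ-injective; toℕ<n; toℕ-fromℕ<; injective⇒≤)
open import Data.Fin.Subset using (Subset; _∈_; _⊂_)
open import Data.Fin.Subset.Induction using (⊂-wellFounded)
open import Data.Vec using (tabulate)
open import Data.Vec.Properties using (lookup∘tabulate; lookup⇒[]=; []=⇒lookup)
open import Data.Bool using (Bool; true; false; not; T)
open import Data.Product using (_×_; ∃-syntax; _,_; proj₁; proj₂)
open import Data.Sum as Sum using (_⊎_; inj₁; inj₂; [_,_]′)
open import Data.Empty using (⊥; ⊥-elim)
open import Function using (_∘_)
open import Function.Bundles using (_⇔_; mk⇔; Equivalence)
open import Function.Construct.Composition using (_⇔-∘_)
open import Induction.WellFounded using (WellFounded; Acc; acc)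
open import Relation.Nullary using (¬_; Dec; yes; no; ¬?; T?; does; map′)
open import Relation.Nullary.Decidable using (_×-dec_; _⊎-dec_; dec-true)
open import Relation.Binary.PropositionalEquality
  using (_≡_; _≢_; refl; sym; trans; cong; subst; subst₂; module ≡-Reasoning)

[m%n+k]%n≡[m+k]%n : ∀ m k n .{{_ : NonZero n}} → (m % n + k) % n ≡ (m + k) % n
[m%n+k]%n≡[m+k]%n m k n = begin
  (m % n + k) % n          ≡⟨ %-distribˡ-+ (m % n) k n ⟩
  (m % n % n + k % n) % n  ≡⟨ cong (λ r → (r + k % n) % n) (m%n%n≡m%n m n) ⟩
  (m % n + k % n) % n      ≡⟨ %-distribˡ-+ m k n ⟨
  (m + k) % n              ∎
  where open ≡-Reasoning

[m+k%n]%n≡[m+k]%n : ∀ m k n .{{_ : NonZero n}} → (m + k % n) % n ≡ (m + k) % n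
[m+k%n]%n≡[m+k]%n m k n = begin
  (m + k % n) % n  ≡⟨ cong (_% n) (+-comm m (k % n)) ⟩
  (k % n + m) % n  ≡⟨ [m%n+k]%n≡[m+k]%n k m n ⟩
  (k + m) % n      ≡⟨ cong (_% n) (+-comm k m) ⟩
  (m + k) % n      ∎
  where open ≡-Reasoning

[m+o]%n≡[k+o]%n⇒m%n≡k%n : ∀ m k o n .{{_ : NonZero n}} → (m + o) % n ≡ (k + o) % n → m % n ≡ k % n
[m+o]%n≡[k+o]%n⇒m%n≡k%n m k o n eq = begin
  m % n                          ≡⟨ undo m ⟨
  ((m + o) % n + pred n * o) % n ≡⟨ cong (λ r → (r + pred n * o) % n) eq ⟩
  ((k + o) % n + pred n * o) % n ≡⟨ undo k ⟩
  k % n                          ∎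
  where
  open ≡-Reasoning
  undo : ∀ r → ((r + o) % n + pred n * o) % n ≡ r % n
  undo r = begin
    ((r + o) % n + pred n * o) % n ≡⟨ [m%n+k]%n≡[m+k]%n (r + o) (pred n * o) n ⟩
    (r + o + pred n * o) % n       ≡⟨ cong (_% n) (+-assoc r o (pred n * o)) ⟩
    (r + suc (pred n) * o) % n     ≡⟨ cong (λ q → (r + q * o) % n) (suc-pred n) ⟩
    (r + n * o) % n                ≡⟨ cong (λ q → (r + q) % n) (*-comm n o) ⟩
    (r + o * n) % n                ≡⟨ [m+kn]%n≡m%n r o n ⟩
    r % n                          ∎

last-index : (P : ℕ → Set) → (∀ t → Dec (P t)) → ∀ L → P 0 →
             ∃[ l ] l ≤ L × P l × (∀ {t} → l < t → t ≤ L → ¬ P t)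
last-index P P? zero p0 = 0 , z≤n , p0 , λ 0<t t≤0 → ⊥-elim (<⇒≱ 0<t t≤0)
last-index P P? (suc L) p0 with P? (suc L)
... | yes pL = suc L , ≤-refl , pL , λ L<t t≤L → ⊥-elim (<⇒≱ L<t t≤L)
... | no ¬pL with l , l≤L , pl , after ← last-index P P? L p0 =
  l , m≤n⇒m≤1+n l≤L , pl ,
  λ l<t t≤L+1 → [ after l<t ∘ s≤s⁻¹ , (λ { refl → ¬pL }) ]′ (m≤n⇒m<n∨m≡n t≤L+1)

∸-suc-injective : ∀ {L t u} → t ≤ L → u ≤ L → L ∸ u ≡ suc (L ∸ t) → t ≡ suc u
∸-suc-injective {L} {t} {u} t≤L u≤L eq = +-cancelˡ-≡ (L ∸ t) t (suc u) (begin
  L ∸ t + t        ≡⟨ m∸n+n≡m t≤L ⟩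
  L                ≡⟨ m∸n+n≡m u≤L ⟨
  L ∸ u + u        ≡⟨ cong (_+ u) eq ⟩
  suc (L ∸ t) + u  ≡⟨ +-suc (L ∸ t) u ⟨
  L ∸ t + suc u    ∎)
  where open ≡-Reasoning

suc-%-cases : ∀ {a N} → a < suc N →
              (suc a < suc N × suc a % suc N ≡ suc a) ⊎ (suc a ≡ suc N × suc a % suc N ≡ 0)
suc-%-cases {a} a<N with m≤n⇒m<n∨m≡n a<N
... | inj₁ a+1<N = inj₁ (a+1<N , m<n⇒m%n≡m a+1<N)
... | inj₂ refl = inj₂ (refl , n%n≡0 (suc a))

module _ {n : ℕ} {P : Fin n → Set} (P? : ∀ v → Dec (P v)) where

  subset-of : Subset n
  subset-of = tabulate (does ∘ P?)

  ∈-subset-of⁺ : ∀ {v} → P v → v ∈ subset-of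
  ∈-subset-of⁺ {v} pv = lookup⇒[]= v subset-of (trans (lookup∘tabulate (does ∘ P?) v) (dec-true (P? v) pv))

  ∈-subset-of⁻ : ∀ {v} → v ∈ subset-of → P v
  ∈-subset-of⁻ {v} v∈ with P? v | trans (sym (lookup∘tabulate (does ∘ P?) v)) ([]=⇒lookup v∈)
  ... | yes pv | _ = pv
  ... | no _ | ()

module Descent {n : ℕ} {A : Set} {_≺_ : A → A → Set} (≺-wellFounded : WellFounded _≺_)
               (R : Fin n → Fin n → Set) (R? : ∀ x y → Dec (R x y)) (μ : Fin n → Fin n → A)
               (μ-shrinks : ∀ {c d e} → R c d → R d e → c ≢ e → μ d e ≺ μ c d) where

  AtMostOneSuccessor : Fin n → Set
  AtMostOneSuccessor k = ∀ {e e′} → R k e → R k e′ → e ≡ e′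

  private
    descend : ∀ {c d} → R c d → Acc _≺_ (μ c d) → ∃[ k ] (∃[ c′ ] R c′ k) × AtMostOneSuccessor k
    descend {c} {d} cRd (acc rs) with any? (λ e → ¬? (e ≟ c) ×-dec R? d e)
    ... | yes (e , e≢c , dRe) = descend dRe (rs (μ-shrinks cRd dRe (e≢c ∘ sym)))
    ... | no none = d , (c , cRd) , λ dRe dRe′ → trans (back dRe) (sym (back dRe′))
      where
      back : ∀ {e} → R d e → e ≡ c
      back {e} dRe with e ≟ c
      ... | yes e≡c = e≡c
      ... | no e≢c = ⊥-elim (none (e , e≢c , dRe))

  ∃-AtMostOneSuccessor : ∀ k₀ → ∃[ k ] (k ≡ k₀ ⊎ ∃[ c ] R c k) × AtMostOneSuccessor k
  ∃-AtMostOneSuccessor k₀ with any? (R? k₀)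
  ... | yes (e , k₀Re) with k , c-R-k , unique ← descend k₀Re (≺-wellFounded _) = k , inj₂ c-R-k , unique
  ... | no none = k₀ , inj₁ refl , λ k₀Re _ → ⊥-elim (none (_ , k₀Re))

module GraphPaths {n : ℕ} (G : Graph n) where

  private variable
    s v x y z : Fin n
    Q Q′ : Fin n → Set

  Adj : Fin n → Fin n → Set
  Adj x y = T (adj G x y)

  Adj? : ∀ x y → Dec (Adj x y)
  Adj? x y = T? (adj G x y)

  adj-sym : Adj x y → Adj y x
  adj-sym {x} {y} = subst T (Graph.sym G x y)

  adj⇒≢ : Adj x y → x ≢ y
  adj⇒≢ {x} x~x refl = subst T (irrefl G x) x~x

  Far : Fin n → Fin n → Set
  Far s v = v ≢ s × ¬ Adj s v

  Far? : ∀ s v → Dec (Far s v)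
  Far? s v = ¬? (v ≟ s) ×-dec ¬? (Adj? s v)

  far-sym : Far s v → Far v s
  far-sym (v≢s , s≁v) = v≢s ∘ sym , s≁v ∘ adj-sym

  FarOr : Fin n → Fin n → Fin n → Set
  FarOr s y v = Far s v ⊎ v ≡ y

  data Walk (Q : Fin n → Set) : Fin n → Fin n → Set where
    []   : Walk Q x x
    step : Adj x z → Q z → Walk Q z y → Walk Q x y

  _++_ : Walk Q x y → Walk Q y z → Walk Q x z
  [] ++ w′ = w′
  step e q w ++ w′ = step e q (w ++ w′)

  reverse-walk : Q x → Walk Q x y → Walk Q y x
  reverse-walk qx [] = []
  reverse-walk qx (step e qz w) = reverse-walk qz w ++ step (adj-sym e) qx []

  walk-end : Walk Q x y → x ≡ y ⊎ Q y
  walk-end [] = inj₁ refl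
  walk-end (step _ qz w) = [ (λ { refl → inj₂ qz }) , inj₂ ]′ (walk-end w)

  map-prefix : (∀ {z} → Walk Q x z → Q z → Q′ z) → Walk Q x y → Walk Q′ x y
  map-prefix f [] = []
  map-prefix f (step e q w) = step e (f (step e q []) q) (map-prefix (f ∘ step e q) w)

  map-suffix : (∀ {z} → Q z → Walk Q z y → Q′ z) → Walk Q x y → Walk Q′ x y
  map-suffix f [] = []
  map-suffix f (step e q w) = step e (f q w) (map-suffix f w)

  ShortWalk : (Fin n → Set) → ℕ → Fin n → Fin n → Set
  ShortWalk Q zero x y = x ≡ y
  ShortWalk Q (suc t) x y = x ≡ y ⊎ ∃[ z ] Adj x z × Q z × ShortWalk Q t z y

  shortWalk? : (∀ v → Dec (Q v)) → ∀ t x y → Dec (ShortWalk Q t x y)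
  shortWalk? Q? zero x y = x ≟ y
  shortWalk? Q? (suc t) x y = x ≟ y ⊎-dec any? (λ z → Adj? x z ×-dec Q? z ×-dec shortWalk? Q? t z y)

  shortWalk⇒walk : ∀ t → ShortWalk Q t x y → Walk Q x y
  shortWalk⇒walk zero refl = []
  shortWalk⇒walk (suc t) (inj₁ refl) = []
  shortWalk⇒walk (suc t) (inj₂ (z , e , q , r)) = step e q (shortWalk⇒walk t r)

  record Path (Q : Fin n → Set) (L : ℕ) (x y : Fin n) : Set where
    field
      vertex    : ℕ → Fin n
      first     : vertex 0 ≡ x
      last      : vertex L ≡ y
      edge      : ∀ {t} → t < L → Adj (vertex t) (vertex (suc t))
      chordless : ∀ {t u} → t ≤ L → u ≤ L → Adj (vertex t) (vertex u) → u ≡ suc t ⊎ t ≡ suc u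
      distinct  : ∀ {t u} → t ≤ L → u ≤ L → vertex t ≡ vertex u → t ≡ u
      avoids    : ∀ {t} → 0 < t → t ≤ L → Q (vertex t)

    OnPath : Fin n → Set
    OnPath v = ∃[ t ] t ≤ L × vertex t ≡ v

    far-after : ∀ {h t} → suc h < t → t ≤ L → Far (vertex h) (vertex t)
    far-after {h} {t} h+1<t t≤L =
        (λ eq → <⇒≢ (<-trans (n<1+n h) h+1<t) (sym (distinct t≤L h≤L eq)))
      , (λ e → [ (λ t≡h+1 → <⇒≢ h+1<t (sym t≡h+1))
               , (λ h≡t+1 → <-asym (<-trans (n<1+n h) h+1<t) (subst (t <_) (sym h≡t+1) (n<1+n t))) ]′
                 (chordless h≤L t≤L e))
      where
      h≤L : h ≤ L
      h≤L = <⇒≤ (<-≤-trans (<-trans (n<1+n h) h+1<t) t≤L)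

    beyond-first : ∀ {t} → 0 < t → t ≤ L → FarOr (vertex 0) (vertex 1) (vertex t)
    beyond-first {suc zero} _ _ = inj₂ refl
    beyond-first {suc (suc t)} _ t≤L = inj₁ (far-after (s≤s (s≤s z≤n)) t≤L)

    forward : ∀ {a b} → a ≤ b → b ≤ L → (∀ {t} → a < t → t ≤ b → Q′ (vertex t)) →
              Walk Q′ (vertex a) (vertex b)
    forward a≤b b≤L = go (≤⇒≤′ a≤b) b≤L
      where
      go : ∀ {a b} → a ≤′ b → b ≤ L → (∀ {t} → a < t → t ≤ b → Q′ (vertex t)) → Walk Q′ (vertex a) (vertex b)
      go ≤′-refl _ _ = []
      go (≤′-step a≤′b) b<L q =
        go a≤′b (<⇒≤ b<L) (λ a<t t≤b → q a<t (m≤n⇒m≤1+n t≤b))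
        ++ step (edge b<L) (q (s≤s (≤′⇒≤ a≤′b)) ≤-refl) []

    backward : ∀ {a b} → a ≤ b → b ≤ L → (∀ {t} → a ≤ t → t < b → Q′ (vertex t)) →
               Walk Q′ (vertex b) (vertex a)
    backward a≤b b≤L = go (≤⇒≤′ a≤b) b≤L
      where
      go : ∀ {a b} → a ≤′ b → b ≤ L → (∀ {t} → a ≤ t → t < b → Q′ (vertex t)) → Walk Q′ (vertex b) (vertex a)
      go ≤′-refl _ _ = []
      go (≤′-step a≤′b) b<L q =
        step (adj-sym (edge b<L)) (q (≤′⇒≤ a≤′b) ≤-refl)
             (go a≤′b (<⇒≤ b<L) (λ a≤t t<b → q a≤t (m<n⇒m<1+n t<b)))

    length<n : L < n
    length<n = injective⇒≤ {f = vertex ∘ toℕ}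
                 (λ eq → toℕ-injective (distinct (s≤s⁻¹ (toℕ<n _)) (s≤s⁻¹ (toℕ<n _)) eq))

    shortWalk : ∀ {t} → L ≤ t → ShortWalk Q t x y
    shortWalk {t} L≤t = subst (λ v → ShortWalk Q t v y) first (go t z≤n L≤t)
      where
      go : ∀ t {i} → i ≤ L → L ≤ i + t → ShortWalk Q t (vertex i) y
      go zero {i} i≤L L≤i = trans (cong vertex (≤-antisym i≤L (subst (L ≤_) (+-identityʳ i) L≤i))) last
      go (suc t) {i} i≤L L≤i+t with m≤n⇒m<n∨m≡n i≤L
      ... | inj₂ refl = inj₁ last
      ... | inj₁ i<L = inj₂ (_ , edge i<L , avoids (s≤s z≤n) i<L , go t i<L (subst (L ≤_) (+-suc i t) L≤i+t))

  module _ {Q : Fin n → Set} {L : ℕ} {x y : Fin n} (P : Path Q L x y) where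
    open Path P

    drop : ∀ l → l ≤ L → Path Q (L ∸ l) (vertex l) y
    drop l l≤L = record
      { vertex    = λ t → vertex (l + t)
      ; first     = cong vertex (+-identityʳ l)
      ; last      = trans (cong vertex (m+[n∸m]≡n l≤L)) last
      ; edge      = λ {t} t<L-l → subst (λ u → Adj (vertex (l + t)) (vertex u)) (sym (+-suc l t)) (edge (shift< t<L-l))
      ; chordless = λ t≤ u≤ e → Sum.map unshift unshift (chordless (shift≤ t≤) (shift≤ u≤) e)
      ; distinct  = λ t≤ u≤ eq → +-cancelˡ-≡ l _ _ (distinct (shift≤ t≤) (shift≤ u≤) eq)
      ; avoids    = λ {t} 0<t t≤ → avoids (<-≤-trans 0<t (m≤n+m t l)) (shift≤ t≤)
      }
      where
      shift≤ : ∀ {t} → t ≤ L ∸ l → l + t ≤ L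
      shift≤ t≤ = ≤-trans (+-monoʳ-≤ l t≤) (≤-reflexive (m+[n∸m]≡n l≤L))
      shift< : ∀ {t} → t < L ∸ l → l + t < L
      shift< t< = <-≤-trans (+-monoʳ-< l t<) (≤-reflexive (m+[n∸m]≡n l≤L))
      unshift : ∀ {t u} → l + u ≡ suc (l + t) → u ≡ suc t
      unshift {t} {u} eq = +-cancelˡ-≡ l u (suc t) (trans eq (sym (+-suc l t)))

    cons : Adj v x → Q x → (∀ {u} → 0 < u → u ≤ L → v ≢ vertex u × ¬ Adj v (vertex u)) → Path Q (suc L) v y
    cons {v} v~x qx clear = record
      { vertex    = vertex′
      ; first     = refl
      ; last      = last
      ; edge      = λ { {zero} _ → v~first ; {suc t} t<L → edge (s≤s⁻¹ t<L) }
      ; chordless = chordless′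
      ; distinct  = distinct′
      ; avoids    = λ { {suc zero} _ _ → subst Q (sym first) qx
                      ; {suc (suc t)} _ t≤L → avoids (s≤s z≤n) (s≤s⁻¹ t≤L) }
      }
      where
      vertex′ : ℕ → Fin n
      vertex′ zero = v
      vertex′ (suc t) = vertex t
      v~first : Adj v (vertex 0)
      v~first = subst (Adj v) (sym first) v~x
      only-first : ∀ {u} → u ≤ L → Adj v (vertex u) → u ≡ 0
      only-first {zero} _ _ = refl
      only-first {suc u} u≤L e = ⊥-elim (proj₂ (clear (s≤s z≤n) u≤L) e)
      chordless′ : ∀ {t u} → t ≤ suc L → u ≤ suc L → Adj (vertex′ t) (vertex′ u) → u ≡ suc t ⊎ t ≡ suc u
      chordless′ {zero} {zero} _ _ e = ⊥-elim (adj⇒≢ e refl)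
      chordless′ {zero} {suc u} _ u≤L e = inj₁ (cong suc (only-first (s≤s⁻¹ u≤L) e))
      chordless′ {suc t} {zero} t≤L _ e = inj₂ (cong suc (only-first (s≤s⁻¹ t≤L) (adj-sym e)))
      chordless′ {suc t} {suc u} t≤L u≤L e =
        Sum.map (cong suc) (cong suc) (chordless (s≤s⁻¹ t≤L) (s≤s⁻¹ u≤L) e)
      v-new : ∀ {u} → u ≤ L → v ≢ vertex u
      v-new {zero} _ eq = adj⇒≢ v~first eq
      v-new {suc u} u≤L = proj₁ (clear (s≤s z≤n) u≤L)
      distinct′ : ∀ {t u} → t ≤ suc L → u ≤ suc L → vertex′ t ≡ vertex′ u → t ≡ u
      distinct′ {zero} {zero} _ _ _ = refl
      distinct′ {zero} {suc u} _ u≤L eq = ⊥-elim (v-new (s≤s⁻¹ u≤L) eq)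
      distinct′ {suc t} {zero} t≤L _ eq = ⊥-elim (v-new (s≤s⁻¹ t≤L) (sym eq))
      distinct′ {suc t} {suc u} t≤L u≤L eq = cong suc (distinct (s≤s⁻¹ t≤L) (s≤s⁻¹ u≤L) eq)

    module _ (Q′ : Fin n → Set) (q : ∀ {t} → t < L → Q′ (vertex t)) where
      reverse-path : Path Q′ L y x
      reverse-path = record
        { vertex    = λ t → vertex (L ∸ t)
        ; first     = last
        ; last      = trans (cong vertex (n∸n≡0 L)) first
        ; edge      = λ {t} t<L → subst (λ u → Adj (vertex u) (vertex (L ∸ suc t))) (sym (+-∸-assoc 1 t<L))
                                        (adj-sym (edge (∸-monoʳ-< (s≤s z≤n) t<L)))
        ; chordless = λ {t} {u} t≤L u≤L e →
            [ inj₂ ∘ ∸-suc-injective t≤L u≤L , inj₁ ∘ ∸-suc-injective u≤L t≤L ]′ (chordless (m∸n≤m L t) (m∸n≤m L u) e)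
        ; distinct  = λ {t} {u} t≤L u≤L eq → ∸-cancelˡ-≡ t≤L u≤L (distinct (m∸n≤m L t) (m∸n≤m L u) eq)
        ; avoids    = λ 0<t t≤L → q (∸-monoʳ-< 0<t t≤L)
        }

      on-reverse-path : OnPath v ⇔ Path.OnPath reverse-path v
      on-reverse-path = mk⇔ (λ (t , t≤L , eq) → L ∸ t , m∸n≤m L t , trans (cong vertex (m∸[m∸n]≡n t≤L)) eq)
                             (λ (t , _ , eq) → L ∸ t , m∸n≤m L t , eq)

  walk⇒path : Walk Q x y → ∃[ L ] Path Q L x y
  walk⇒path {Q} {x} [] = 0 , record
    { vertex    = λ _ → x
    ; first     = refl
    ; last      = refl
    ; edge      = λ ()
    ; chordless = λ _ _ e → ⊥-elim (adj⇒≢ e refl)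
    ; distinct  = λ t≤0 u≤0 _ → trans (n≤0⇒n≡0 t≤0) (sym (n≤0⇒n≡0 u≤0))
    ; avoids    = λ 0<t t≤0 → ⊥-elim (<⇒≱ 0<t t≤0)
    }
  walk⇒path {Q} {v} (step v~x qx w) with L , P ← walk⇒path w =
    shortcut (last-index Touches (λ t → v ≟ vertex t ⊎-dec Adj? v (vertex t)) L (inj₂ (subst (Adj v) (sym first) v~x)))
    where
    open Path P
    Touches : ℕ → Set
    Touches t = v ≡ vertex t ⊎ Adj v (vertex t)
    satisfies : ∀ t → t ≤ L → Q (vertex t)
    satisfies zero _ = subst Q (sym first) qx
    satisfies (suc t) t≤L = avoids (s≤s z≤n) t≤L
    -- v is attached to the path at the last vertex it touches, so that the result is again induced
    shortcut : ∃[ l ] l ≤ L × Touches l × (∀ {t} → l < t → t ≤ L → ¬ Touches t) → ∃[ L′ ] Path Q L′ v _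
    shortcut (l , l≤L , inj₁ v≡l , _) = L ∸ l , subst (λ u → Path Q (L ∸ l) u _) (sym v≡l) (drop P l l≤L)
    shortcut (l , l≤L , inj₂ v~l , after) = suc (L ∸ l) , cons (drop P l l≤L) v~l (satisfies l l≤L) clear
      where
      clear : ∀ {u} → 0 < u → u ≤ L ∸ l → v ≢ vertex (l + u) × ¬ Adj v (vertex (l + u))
      clear {u} 0<u u≤ = ¬touch ∘ inj₁ , ¬touch ∘ inj₂
        where
        ¬touch : ¬ Touches (l + u)
        ¬touch = after (subst (_≤ l + u) (+-comm l 1) (+-monoʳ-≤ l 0<u))
                       (≤-trans (+-monoʳ-≤ l u≤) (≤-reflexive (m+[n∸m]≡n l≤L)))

  walk? : (∀ v → Dec (Q v)) → ∀ x y → Dec (Walk Q x y)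
  walk? Q? x y = map′ (shortWalk⇒walk n) shorten (shortWalk? Q? n x y)
    where
    shorten : Walk Q x y → ShortWalk Q n x y
    shorten w = let _ , P = walk⇒path w in Path.shortWalk P (<⇒≤ (Path.length<n P))

  next-toℕ : ∀ {m} (i : Fin (suc m)) → toℕ (next i) ≡ suc (toℕ i) % suc m
  next-toℕ i = toℕ-fromℕ< _

  ring-cycle : (m : ℕ) (f : ℕ → Fin n) →
    (∀ {a b} → a < 3 + m → b < 3 + m → f a ≡ f b → a ≡ b) →
    (∀ {a b} → a < 3 + m → b < 3 + m → Adj (f a) (f b) → b ≡ suc a % (3 + m) ⊎ a ≡ suc b % (3 + m)) →
    (∀ {a} → a < 3 + m → Adj (f a) (f (suc a % (3 + m)))) →
    ChordlessCycle G
  ring-cycle m f injective adjacent edge = record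
    { m       = m
    ; vert    = f ∘ toℕ
    ; inj     = λ eq → toℕ-injective (injective (toℕ<n _) (toℕ<n _) eq)
    ; induced = λ i j → mk⇔ (to i j) (from i j)
    }
    where
    to : ∀ i j → Adj (f (toℕ i)) (f (toℕ j)) → Consec i j
    to i j e = Sum.map (λ eq → toℕ-injective (trans eq (sym (next-toℕ i))))
                       (λ eq → toℕ-injective (trans eq (sym (next-toℕ j))))
                       (adjacent (toℕ<n i) (toℕ<n j) e)
    from : ∀ i j → Consec i j → Adj (f (toℕ i)) (f (toℕ j))
    from i _ (inj₁ refl) = subst (Adj (f (toℕ i)) ∘ f) (sym (next-toℕ i)) (edge (toℕ<n i))
    from _ j (inj₂ refl) = adj-sym (subst (Adj (f (toℕ j)) ∘ f) (sym (next-toℕ j)) (edge (toℕ<n j)))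

  -- An induced path from x to y whose inner vertices are far from s; with s it closes up to a chordless cycle.
  record Detour (s x y : Fin n) : Set where
    field
      interior : ℕ
      path     : Path (FarOr s y) (suc interior) x y
      s~x      : Adj s x
      s~y      : Adj s y

    open Path path public

    length : ℕ
    length = suc interior

    interior-far : ∀ {t} → 0 < t → t < length → Far s (vertex t)
    interior-far 0<t t<L with avoids 0<t (<⇒≤ t<L)
    ... | inj₁ far = far
    ... | inj₂ t-is-y = ⊥-elim (<⇒≢ t<L (distinct (<⇒≤ t<L) ≤-refl (trans t-is-y (sym last))))

    off-path : ∀ {t} → t ≤ length → vertex t ≢ s
    off-path {zero} _ eq = adj⇒≢ s~x (sym (trans (sym first) eq))
    off-path {suc t} t≤L eq with m≤n⇒m<n∨m≡n t≤L
    ... | inj₁ t<L = proj₁ (interior-far (s≤s z≤n) t<L) eq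
    ... | inj₂ refl = adj⇒≢ s~y (sym (trans (sym last) eq))

    adjacent-ends : ∀ {t} → t ≤ length → Adj s (vertex t) → t ≡ 0 ⊎ t ≡ length
    adjacent-ends {zero} _ _ = inj₁ refl
    adjacent-ends {suc t} t≤L e with m≤n⇒m<n∨m≡n t≤L
    ... | inj₁ t<L = ⊥-elim (proj₂ (interior-far (s≤s z≤n) t<L) e)
    ... | inj₂ t≡L = inj₂ t≡L

    OnDetour : Fin n → Set
    OnDetour v = v ≡ s ⊎ OnPath v

    ring : ℕ → Fin n
    ring zero = s
    ring (suc t) = vertex t

    private
      N : ℕ
      N = 3 + interior

      on-path : ∀ {t} → suc t < N → t ≤ length
      on-path = s≤s⁻¹ ∘ s≤s⁻¹

      ring-injective : ∀ {a b} → a < N → b < N → ring a ≡ ring b → a ≡ b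
      ring-injective {zero} {zero} _ _ _ = refl
      ring-injective {zero} {suc u} _ u<N eq = ⊥-elim (off-path (on-path u<N) (sym eq))
      ring-injective {suc t} {zero} t<N _ eq = ⊥-elim (off-path (on-path t<N) eq)
      ring-injective {suc t} {suc u} t<N u<N eq = cong suc (distinct (on-path t<N) (on-path u<N) eq)

      ring-adjacent : ∀ {a b} → a < N → b < N → Adj (ring a) (ring b) → b ≡ suc a % N ⊎ a ≡ suc b % N
      ring-adjacent {zero} {zero} _ _ e = ⊥-elim (adj⇒≢ e refl)
      ring-adjacent {zero} {suc u} _ u<N e with adjacent-ends (on-path u<N) e
      ... | inj₁ refl = inj₁ refl
      ... | inj₂ refl = inj₂ (sym (n%n≡0 N))
      ring-adjacent {suc t} {zero} t<N _ e with adjacent-ends (on-path t<N) (adj-sym e)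
      ... | inj₁ refl = inj₂ refl
      ... | inj₂ refl = inj₁ (sym (n%n≡0 N))
      ring-adjacent {suc t} {suc u} t<N u<N e with chordless (on-path t<N) (on-path u<N) e
      ... | inj₁ refl = inj₁ (sym (m<n⇒m%n≡m u<N))
      ... | inj₂ refl = inj₂ (sym (m<n⇒m%n≡m t<N))

      ring-edge : ∀ {a} → a < N → Adj (ring a) (ring (suc a % N))
      ring-edge {a} a<N with suc-%-cases a<N
      ... | inj₂ (refl , a+1%N≡0) = subst (Adj (ring a) ∘ ring) (sym a+1%N≡0) (adj-sym (subst (Adj s) (sym last) s~y))
      ... | inj₁ (a+1<N , a+1%N≡a+1) = subst (Adj (ring a) ∘ ring) (sym a+1%N≡a+1) (ring-step a a+1<N)
        where
        ring-step : ∀ a → suc a < N → Adj (ring a) (ring (suc a))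
        ring-step zero _ = subst (Adj s) (sym first) s~x
        ring-step (suc t) t+2<N = edge (s≤s⁻¹ (s≤s⁻¹ t+2<N))

    cycle : ChordlessCycle G
    cycle = ring-cycle interior ring ring-injective ring-adjacent ring-edge

  module _ {s x y : Fin n} (F : Detour s x y) where
    open Detour F

    private
      start-or-far : ∀ {t} → t < length → FarOr s x (vertex t)
      start-or-far {zero} _ = inj₂ first
      start-or-far {suc t} t<L = inj₁ (interior-far (s≤s z≤n) t<L)

    reverse : Detour s y x
    reverse = record
      { interior = interior
      ; path     = reverse-path path (FarOr s x) start-or-far
      ; s~x      = s~y
      ; s~y      = s~x
      }

    on-reverse : ∀ {v} → OnDetour v ⇔ Detour.OnDetour reverse v
    on-reverse = mk⇔ (Sum.map₂ (Equivalence.to (on-reverse-path path (FarOr s x) start-or-far)))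
                     (Sum.map₂ (Equivalence.from (on-reverse-path path (FarOr s x) start-or-far)))

  walk⇒detour : x ≢ y → Adj s x → Adj s y → Walk (FarOr s y) x y → Detour s x y
  walk⇒detour x≢y s~x s~y w with walk⇒path w
  ... | zero , P = ⊥-elim (x≢y (trans (sym (Path.first P)) (Path.last P)))
  ... | suc ℓ , P = record { interior = ℓ ; path = P ; s~x = s~x ; s~y = s~y }

  detour⇒walk : Detour s x y → Walk (FarOr s y) x y
  detour⇒walk F = subst₂ (Walk _) first last (forward z≤n ≤-refl avoids)
    where open Detour F

  detour-ends-differ : Detour s x y → x ≢ y
  detour-ends-differ F x≡y = 1+n≢0 (distinct ≤-refl z≤n (trans last (trans (sym x≡y) (sym first))))
    where open Detour F

  record Opening (C : ChordlessCycle G) (s x : Fin n) : Set where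
    field
      {end}    : Fin n
      detour   : Detour s x end
      vertices : ∀ {v} → OnCycle C v ⇔ Detour.OnDetour detour v

  module Around (C : ChordlessCycle G) where
    private
      N : ℕ
      N = 3 + m C
      L : ℕ
      L = suc (m C)

    at : ℕ → Fin n
    at t = vert C (t mod N)

    private
      toℕ-mod : ∀ t → toℕ (t mod N) ≡ t % N
      toℕ-mod t = toℕ-fromℕ< _

      suc-mod : ∀ t → suc t mod N ≡ next (t mod N)
      suc-mod t = toℕ-injective (begin
        toℕ (suc t mod N)         ≡⟨ toℕ-mod (suc t) ⟩
        suc t % N                 ≡⟨ %-distribˡ-+ 1 t N ⟩
        suc (t % N) % N           ≡⟨ cong (λ r → suc r % N) (toℕ-mod t) ⟨
        suc (toℕ (t mod N)) % N   ≡⟨ next-toℕ (t mod N) ⟨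
        toℕ (next (t mod N))      ∎)
        where open ≡-Reasoning

    at-cong : ∀ {t u} → t % N ≡ u % N → at t ≡ at u
    at-cong {t} {u} eq = cong (vert C) (toℕ-injective (trans (toℕ-mod t) (trans eq (sym (toℕ-mod u)))))

    at-injective : ∀ {t u} → at t ≡ at u → t % N ≡ u % N
    at-injective {t} {u} eq = trans (sym (toℕ-mod t)) (trans (cong toℕ (inj C eq)) (toℕ-mod u))

    at-toℕ : ∀ i → at (toℕ i) ≡ vert C i
    at-toℕ i = cong (vert C) (toℕ-injective (trans (toℕ-mod (toℕ i)) (m<n⇒m%n≡m (toℕ<n i))))

    at-edge : ∀ t → Adj (at t) (at (suc t))
    at-edge t = Equivalence.from (induced C (t mod N) (suc t mod N)) (inj₁ (suc-mod t))

    at-adjacent : ∀ {t u} → Adj (at t) (at u) → u % N ≡ suc t % N ⊎ t % N ≡ suc u % N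
    at-adjacent {t} {u} e =
      Sum.map (successor t u) (successor u t) (Equivalence.to (induced C (t mod N) (u mod N)) e)
      where
      successor : ∀ t u → u mod N ≡ next (t mod N) → u % N ≡ suc t % N
      successor t u eq = trans (sym (toℕ-mod u)) (trans (cong toℕ (trans eq (sym (suc-mod t)))) (toℕ-mod (suc t)))

    module _ (i : Fin N) where
      private
        a : ℕ
        a = toℕ i

        shifted-injective : ∀ {d e} → d < N → e < N → (d + a) % N ≡ (e + a) % N → d ≡ e
        shifted-injective {d} {e} d<N e<N eq =
          trans (sym (m<n⇒m%n≡m d<N)) (trans ([m+o]%n≡[k+o]%n⇒m%n≡k%n d e a N eq) (m<n⇒m%n≡m e<N))

        after-successor : ∀ {t u} → t ≤ L → u ≤ L → (suc u + a) % N ≡ (suc (suc t) + a) % N → u ≡ suc t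
        after-successor {t} {u} t≤L u≤L eq with m≤n⇒m<n∨m≡n t≤L
        ... | inj₁ t<L = suc-injective (shifted-injective (s≤s (s≤s u≤L)) (s≤s (s≤s t<L)) eq)
        ... | inj₂ refl =
          ⊥-elim (1+n≢0 (shifted-injective (s≤s (s≤s u≤L)) (s≤s z≤n) (trans eq (%-remove-+ˡ a (∣-refl {N})))))

        path : Path (FarOr (at a) (at (suc L + a))) L (at (suc a)) (at (suc L + a))
        path = record
          { vertex    = λ t → at (suc t + a)
          ; first     = refl
          ; last      = refl
          ; edge      = λ {t} _ → at-edge (suc t + a)
          ; chordless = λ {t} {u} t≤L u≤L e → Sum.map (after-successor t≤L u≤L) (after-successor u≤L t≤L)
                                                      (at-adjacent {suc t + a} {suc u + a} e)
          ; distinct  = λ {t} {u} t≤L u≤L eq → suc-injective (shifted-injective (s≤s (s≤s t≤L)) (s≤s (s≤s u≤L))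
                                                                                (at-injective {suc t + a} {suc u + a} eq))
          ; avoids    = avoids
          }
          where
          avoids : ∀ {t} → 0 < t → t ≤ L → FarOr (at a) (at (suc L + a)) (at (suc t + a))
          avoids {t} 0<t t≤L with m≤n⇒m<n∨m≡n t≤L
          ... | inj₂ refl = inj₂ refl
          ... | inj₁ t<L =
            inj₁ ( 1+n≢0 ∘ shifted-injective (s≤s (s≤s t≤L)) (s≤s z≤n) ∘ at-injective {suc t + a} {a}
                 , [ <⇒≢ 0<t ∘ sym ∘ suc-injective ∘ shifted-injective (s≤s (s≤s t≤L)) (s≤s (s≤s z≤n))
                   , 0≢1+n ∘ shifted-injective (s≤s z≤n) (s≤s (s≤s t<L)) ]′ ∘ at-adjacent {a} {suc t + a} )

      detour : Detour (at a) (at (suc a)) (at (suc L + a))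
      detour = record
        { interior = m C
        ; path     = path
        ; s~x      = at-edge a
        ; s~y      = adj-sym (subst (Adj (at (suc L + a))) (at-cong {N + a} {a} (%-remove-+ˡ a (∣-refl {N})))
                                    (at-edge (suc L + a)))
        }

      vertices : ∀ {v} → OnCycle C v ⇔ Detour.OnDetour detour v
      vertices = mk⇔
        (λ (b , eq) → subst (Detour.OnDetour detour) eq (locate b (m%n<n (toℕ b + (N ∸ a)) N) (position b)))
        [ (λ v≡s → i , trans (sym (at-toℕ i)) (sym v≡s)) , (λ (t , _ , eq) → (suc t + a) mod N , eq) ]′
        where
        position : ∀ b → ((toℕ b + (N ∸ a)) % N + a) % N ≡ toℕ b % N
        position b = begin
          ((toℕ b + (N ∸ a)) % N + a) % N  ≡⟨ [m%n+k]%n≡[m+k]%n (toℕ b + (N ∸ a)) a N ⟩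
          (toℕ b + (N ∸ a) + a) % N        ≡⟨ cong (_% N) (+-assoc (toℕ b) (N ∸ a) a) ⟩
          (toℕ b + (N ∸ a + a)) % N        ≡⟨ cong (λ r → (toℕ b + r) % N) (m∸n+n≡m (<⇒≤ (toℕ<n i))) ⟩
          (toℕ b + N) % N                  ≡⟨ [m+n]%n≡m%n (toℕ b) N ⟩
          toℕ b % N                        ∎
          where open ≡-Reasoning
        locate : ∀ b {d} → d < N → (d + a) % N ≡ toℕ b % N → Detour.OnDetour detour (vert C b)
        locate b {zero} _ pos = inj₁ (trans (sym (at-toℕ b)) (at-cong {toℕ b} {a} (sym pos)))
        locate b {suc t} t+1<N pos =
          inj₂ (t , s≤s⁻¹ (s≤s⁻¹ t+1<N) , trans (at-cong {suc t + a} {toℕ b} pos) (at-toℕ b))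

    private
      at-before : ∀ i → at (suc L + toℕ (next i)) ≡ vert C i
      at-before i = trans (at-cong {suc L + toℕ (next i)} {toℕ i} (begin
        (suc L + toℕ (next i)) % N        ≡⟨ cong (λ r → (suc L + r) % N) (next-toℕ i) ⟩
        (suc L + suc (toℕ i) % N) % N     ≡⟨ [m+k%n]%n≡[m+k]%n (suc L) (suc (toℕ i)) N ⟩
        (suc L + suc (toℕ i)) % N         ≡⟨ cong (_% N) (+-suc (suc L) (toℕ i)) ⟩
        (N + toℕ i) % N                   ≡⟨ %-remove-+ˡ (toℕ i) (∣-refl {N}) ⟩
        toℕ i % N                         ∎)) (at-toℕ i)
        where open ≡-Reasoning

      relabel : ∀ {s x s′ x′ y} → s′ ≡ s → x′ ≡ x → (F : Detour s′ x′ y) →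
                (∀ {v} → OnCycle C v ⇔ Detour.OnDetour F v) → Opening C s x
      relabel refl refl F same = record { detour = F ; vertices = same }

    opening : ∀ {s x} → EdgeOf C s x → Opening C s x
    opening (i , inj₁ (refl , refl)) = relabel (at-toℕ i) refl (detour i) (vertices i)
    opening (i , inj₂ (refl , refl)) =
      relabel (at-toℕ (next i)) (at-before i) (reverse (detour (next i)))
              (on-reverse (detour (next i)) ⇔-∘ vertices (next i))

module Oriented {n : ℕ} (G : Graph n) (O : Orientation G)
                (cyclic : ∀ (C : ChordlessCycle G) → CyclicallyOriented O C) where
  open GraphPaths G

  private variable
    c d e s x y z : Fin n
    δ : Bool

  _⟶_ : Fin n → Fin n → Set
  x ⟶ y = T (arc O x y)

  _⟶⟨_⟩_ : Fin n → Bool → Fin n → Set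
  x ⟶⟨ true ⟩ y = x ⟶ y
  x ⟶⟨ false ⟩ y = y ⟶ x

  ⟶-asym : x ⟶ y → ¬ y ⟶ x
  ⟶-asym {x} {y} x⟶y y⟶x with edge-arc O x y (arc-edge O x y x⟶y)
  ... | inj₁ (_ , ¬y⟶x) = ¬y⟶x y⟶x
  ... | inj₂ (_ , ¬x⟶y) = ¬x⟶y x⟶y

  ⟶⟨⟩-asym : ∀ δ → x ⟶⟨ δ ⟩ y → ¬ y ⟶⟨ δ ⟩ x
  ⟶⟨⟩-asym true = ⟶-asym
  ⟶⟨⟩-asym false = ⟶-asym

  flip : ∀ δ → x ⟶⟨ δ ⟩ y → y ⟶⟨ not δ ⟩ x
  flip true x⟶y = x⟶y
  flip false y⟶x = y⟶x

  unflip : ∀ δ → x ⟶⟨ not δ ⟩ y → y ⟶⟨ δ ⟩ x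
  unflip true y⟶x = y⟶x
  unflip false x⟶y = x⟶y

  direction-unique : ∀ δ δ′ → x ⟶⟨ δ ⟩ y → x ⟶⟨ δ′ ⟩ y → δ ≡ δ′
  direction-unique true true _ _ = refl
  direction-unique false false _ _ = refl
  direction-unique true false x⟶y y⟶x = ⊥-elim (⟶-asym x⟶y y⟶x)
  direction-unique false true y⟶x x⟶y = ⊥-elim (⟶-asym x⟶y y⟶x)

  SameSide : Fin n → Fin n → Fin n → Set
  SameSide s x y = ∃[ δ ] s ⟶⟨ δ ⟩ x × s ⟶⟨ δ ⟩ y

  cycle-direction : (C : ChordlessCycle G) → ∃[ δ ] ∀ i → vert C i ⟶⟨ δ ⟩ vert C (next i)
  cycle-direction C = [ (true ,_) , (false ,_) ]′ (cyclic C)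

  DetourOriented : Bool → Detour s x y → Set
  DetourOriented {s} {x} {y} δ F =
    s ⟶⟨ δ ⟩ x × y ⟶⟨ δ ⟩ s × (∀ {t} → t < length → vertex t ⟶⟨ δ ⟩ vertex (suc t))
    where open Detour F

  detour-oriented : (F : Detour s x y) → ∃[ δ ] DetourOriented δ F
  detour-oriented {s} {x} {y} F with δ , along ← cycle-direction (Detour.cycle F) =
      δ
    , subst (s ⟶⟨ δ ⟩_) first (around (s≤s z≤n))
    , subst₂ (_⟶⟨ δ ⟩_) last (cong ring (n%n≡0 N)) (around ≤-refl)
    , λ t<L → subst (vertex _ ⟶⟨ δ ⟩_) (cong ring (m<n⇒m%n≡m (s≤s (s≤s t<L))))
                    (around (s≤s (<⇒≤ (s≤s t<L))))
    where
    open Detour F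
    N : ℕ
    N = 3 + interior
    around : ∀ {a} → a < N → ring a ⟶⟨ δ ⟩ ring (suc a % N)
    around a<N = subst₂ (λ u w → ring u ⟶⟨ δ ⟩ ring w)
                        (toℕ-fromℕ< a<N)
                        (trans (next-toℕ (fromℕ< a<N)) (cong (λ r → suc r % N) (toℕ-fromℕ< a<N)))
                        (along (fromℕ< a<N))

  separated : SameSide s x y → x ≢ y → Adj s x → Adj s y → ¬ Walk (FarOr s y) x y
  separated (δ , s⟶x , s⟶y) x≢y s~x s~y w with detour-oriented (walk⇒detour x≢y s~x s~y w)
  ... | δ′ , s⟶′x , y⟶′s , _ with refl ← direction-unique δ δ′ s⟶x s⟶′x = ⟶⟨⟩-asym δ s⟶y y⟶′s

  module _ {s x y : Fin n} (F₁ F₂ : Detour s x y) where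
    open Detour F₁ renaming (length to L₁; vertex to p₁; first to first₁; last to last₁; edge to edge₁;
                             distinct to distinct₁; forward to forward₁; far-after to far-after₁)
    open Detour F₂ renaming (length to L₂; vertex to p₂; first to first₂; last to last₂; edge to edge₂;
                             backward to backward₂; far-after to far-after₂)

    co-oriented-detours-agree : (∀ {t} → t < L₁ → p₁ t ⟶⟨ δ ⟩ p₁ (suc t)) →
                                (∀ {t} → t < L₂ → p₂ t ⟶⟨ δ ⟩ p₂ (suc t)) →
                                ∀ {t} → t ≤ L₁ → t ≤ L₂ × p₁ t ≡ p₂ t
    co-oriented-detours-agree {δ} step₁ step₂ = agree
      where
      agree-suc : ∀ {h} → h < L₁ → h ≤ L₂ → p₁ h ≡ p₂ h → h < L₂ × p₁ (suc h) ≡ p₂ (suc h)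
      agree-suc {h} h<L₁ h≤L₂ same = h<L₂ , next-agrees
        where
        h<L₂ : h < L₂
        h<L₂ = ≤∧≢⇒< h≤L₂ λ { refl →
                 <⇒≢ h<L₁ (distinct₁ (<⇒≤ h<L₁) ≤-refl (trans same (trans last₂ (sym last₁)))) }
        z₁ = p₁ (suc h)
        z₂ = p₂ (suc h)
        walk : Walk (FarOr (p₁ h) z₂) z₁ z₂
        walk = subst (Walk _ z₁) (trans last₁ (sym last₂))
                     (forward₁ h<L₁ ≤-refl (λ h+1<t t≤L → inj₁ (far-after₁ h+1<t t≤L)))
            ++ backward₂ h<L₂ ≤-refl λ {t} h+1≤t t<L →
                 [ (λ h+1<t → inj₁ (subst (λ u → Far u (p₂ t)) (sym same) (far-after₂ h+1<t (<⇒≤ t<L))))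
                 , (λ { refl → inj₂ refl }) ]′ (m≤n⇒m<n∨m≡n h+1≤t)
        -- otherwise the two tails form a walk between two neighbours of p₁ h lying on the same side of it
        next-agrees : z₁ ≡ z₂
        next-agrees with z₁ ≟ z₂
        ... | yes z₁≡z₂ = z₁≡z₂
        ... | no z₁≢z₂ = ⊥-elim (separated (δ , step₁ h<L₁ , subst (_⟶⟨ δ ⟩ z₂) (sym same) (step₂ h<L₂))
                                           z₁≢z₂ (edge₁ h<L₁) (subst (λ u → Adj u z₂) (sym same) (edge₂ h<L₂)) walk)

      agree : ∀ {t} → t ≤ L₁ → t ≤ L₂ × p₁ t ≡ p₂ t
      agree {zero} _ = z≤n , trans first₁ (sym first₂)
      agree {suc h} h<L₁ = agree-suc h<L₁ (proj₁ (agree (<⇒≤ h<L₁))) (proj₂ (agree (<⇒≤ h<L₁)))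

    detour-unique : ∀ {v} → Detour.OnDetour F₁ v → Detour.OnDetour F₂ v
    detour-unique with detour-oriented F₁ | detour-oriented F₂
    ... | δ , s⟶x , _ , step₁ | δ′ , s⟶′x , _ , step₂ with refl ← direction-unique δ δ′ s⟶x s⟶′x =
      [ inj₁ , (λ (t , t≤L₁ , eq) → let t≤L₂ , same = co-oriented-detours-agree {δ} step₁ step₂ t≤L₁
                                    in inj₂ (t , t≤L₂ , trans (sym same) eq)) ]′

  opposite-orientations : (F₁ : Detour s c d) (F₂ : Detour s d e) →
                          ∃[ δ ] DetourOriented δ F₁ × DetourOriented (not δ) F₂
  opposite-orientations F₁ F₂ with detour-oriented F₁ | detour-oriented F₂
  ... | δ , o₁@(_ , d⟶s , _) | δ₂ , o₂@(s⟶d , _ , _)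
      with refl ← direction-unique δ₂ (not δ) s⟶d (flip δ d⟶s) = δ , o₁ , o₂

  same-side-across : Detour s c d → Detour s d e → SameSide s c e
  same-side-across F₁ F₂ with δ , (s⟶c , _ , _) , (_ , e⟶s , _) ← opposite-orientations F₁ F₂ =
    δ , s⟶c , unflip δ e⟶s

  avoiding-d⇒avoiding-c : (F₁ : Detour s c d) (F₂ : Detour s d e) → c ≢ e → Walk (Far d) e z → Far c z
  avoiding-d⇒avoiding-c {s} {c} {d} {e} {z} F₁ F₂ c≢e w = no-contact ∘ inj₁ , no-contact ∘ inj₂ ∘ adj-sym
    where
    open Detour F₁ renaming (interior to l₁; vertex to p₁; first to first₁; last to last₁; edge to edge₁; s~x to s~c;
                             forward to forward₁; backward to backward₁; far-after to far-after₁; interior-far to interior-far₁)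
    open Detour F₂ renaming (interior to l₂; vertex to p₂; first to first₂; last to last₂; edge to edge₂; s~y to s~e;
                             forward to forward₂; backward to backward₂; beyond-first to beyond-first₂; avoids to avoids₂)
    x₁ = p₁ l₁
    x₂ = p₂ 1
    Q = FarOr d x₂

    d~x₁ : Adj d x₁
    d~x₁ = adj-sym (subst (Adj x₁) last₁ (edge₁ ≤-refl))
    d~x₂ : Adj d x₂
    d~x₂ = subst (λ u → Adj u x₂) first₂ (edge₂ (s≤s z≤n))

    same-side : SameSide d x₁ x₂
    same-side with δ , (_ , _ , step₁) , (_ , _ , step₂) ← opposite-orientations F₁ F₂ =
      not δ , flip δ (subst (x₁ ⟶⟨ δ ⟩_) last₁ (step₁ ≤-refl))
            , subst (_⟶⟨ not δ ⟩ x₂) first₂ (step₂ (s≤s z≤n))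

    x₁≢x₂ : x₁ ≢ x₂
    x₁≢x₂ x₁≡x₂ = separated (same-side-across F₁ F₂) c≢e s~c s~e
      (subst₂ (Walk (FarOr s e)) first₁ last₂
        (forward₁ z≤n (n≤1+n l₁) (λ 0<t t≤l₁ → inj₁ (interior-far₁ 0<t (s≤s t≤l₁)))
         ++ subst (λ u → Walk _ u (p₂ (suc l₂))) (sym x₁≡x₂)
                  (forward₂ (s≤s z≤n) ≤-refl (λ 1<t → avoids₂ (<-trans (s≤s z≤n) 1<t)))))

    after-d : ∀ {t} → 0 < t → t ≤ suc l₂ → Q (p₂ t)
    after-d 0<t t≤L = subst (λ u → FarOr u x₂ (p₂ _)) first₂ (beyond-first₂ 0<t t≤L)

    q-e : Q e
    q-e = subst Q last₂ (after-d (s≤s z≤n) ≤-refl)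

    x₁-to-c : Walk Q x₁ c
    x₁-to-c = subst (Walk Q x₁) first₁ (backward₁ z≤n (n≤1+n l₁) λ {t} _ t<l₁ →
                inj₁ (subst (λ u → Far u (p₁ t)) last₁ (far-sym (far-after₁ (s≤s t<l₁) ≤-refl))))

    z-to-e : Walk Q z e
    z-to-e = reverse-walk q-e (map-suffix (λ far _ → inj₁ far) w)

    e-to-x₂ : Walk Q e x₂
    e-to-x₂ = subst (λ u → Walk Q u x₂) last₂ (backward₂ (s≤s z≤n) ≤-refl λ 0<t t<L → after-d 0<t (<⇒≤ t<L))

    -- touching c would close a walk around c between the neighbours x₁, x₂ of d, which lie on the same side of d
    no-contact : z ≡ c ⊎ Adj z c → ⊥
    no-contact contact = separated same-side x₁≢x₂ d~x₁ d~x₂ (x₁-to-c ++ (c-to-z contact ++ (z-to-e ++ e-to-x₂)))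
      where
      c-to-z : z ≡ c ⊎ Adj z c → Walk Q c z
      c-to-z (inj₁ refl) = []
      c-to-z (inj₂ z~c) = step (adj-sym z~c) ([ (λ e≡z → subst Q e≡z q-e) , inj₁ ]′ (walk-end w)) []

  module Partners (j : Fin n) where

    Partner : Fin n → Fin n → Set
    Partner x y = x ≢ y × Adj j x × Adj j y × Walk (FarOr j y) x y

    Partner? : ∀ x y → Dec (Partner x y)
    Partner? x y = ¬? (x ≟ y) ×-dec Adj? j x ×-dec Adj? j y ×-dec walk? (λ v → Far? j v ⊎-dec v ≟ y) x y

    partner⇒detour : Partner x y → Detour j x y
    partner⇒detour (x≢y , j~x , j~y , w) = walk⇒detour x≢y j~x j~y w

    detour⇒partner : Detour j x y → Partner x y
    detour⇒partner F = detour-ends-differ F , s~x , s~y , detour⇒walk F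
      where open Detour F

    reach-inclusion : ∀ {v} → Partner c d → Partner d e → c ≢ e → Walk (Far d) e v → Walk (Far c) d v
    reach-inclusion {c} {d} {e} Pcd@(_ , j~c , _) Pde@(_ , _ , j~e , d⇝e) c≢e w =
      map-suffix stays-far d⇝e ++ map-prefix (λ prefix _ → avoiding-d⇒avoiding-c F₁ F₂ c≢e prefix) w
      where
      F₁ = partner⇒detour Pcd
      F₂ = partner⇒detour Pde
      stays-far : ∀ {z} → FarOr j e z → Walk (FarOr j e) z e → Far c z
      stays-far q rest = [ (λ far z≡c → proj₂ far (subst (Adj j) (sym z≡c) j~c))
                         , (λ z≡e z≡c → c≢e (trans (sym z≡c) z≡e)) ]′ q
                       , λ c~z → separated (same-side-across F₁ F₂) c≢e j~c j~e (step c~z q rest)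

    Reachable : Fin n → Fin n → Subset n
    Reachable c d = subset-of (walk? (Far? c) d)

    reachable-shrinks : Partner c d → Partner d e → c ≢ e → Reachable d e ⊂ Reachable c d
    reachable-shrinks {c} {d} {e} Pcd Pde@(d≢e , _) c≢e =
        (∈-subset-of⁺ (walk? (Far? c) d) ∘ reach-inclusion Pcd Pde c≢e ∘ ∈-subset-of⁻ (walk? (Far? d) e))
      , d , ∈-subset-of⁺ (walk? (Far? c) d) []
      , λ d∈ → [ d≢e ∘ sym , (λ far → proj₁ far refl) ]′ (walk-end (∈-subset-of⁻ (walk? (Far? d) e) d∈))

    open Descent ⊂-wellFounded Partner Partner? Reachable reachable-shrinks public

    neighbour-with-one-partner : ∀ {k₀} → Adj j k₀ → ∃[ k ] Adj j k × AtMostOneSuccessor k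
    neighbour-with-one-partner {k₀} j~k₀ with k , origin , unique ← ∃-AtMostOneSuccessor k₀ =
      k , [ (λ { refl → j~k₀ }) , (λ (_ , (_ , _ , j~k , _)) → j~k) ]′ origin , unique

    one-cycle-through : ∀ {k} → AtMostOneSuccessor k →
                        ∀ (C D : ChordlessCycle G) → EdgeOf C j k → EdgeOf D j k → SameCycle C D
    one-cycle-through unique C D eC eD with Around.opening C eC | Around.opening D eD
    ... | record { detour = F ; vertices = C≈F } | record { detour = F′ ; vertices = D≈F′ }
        with refl ← unique (detour⇒partner F) (detour⇒partner F′) =
      λ v → mk⇔ (Equivalence.from D≈F′ ∘ detour-unique F F′ ∘ Equivalence.to C≈F)
                (Equivalence.from C≈F ∘ detour-unique F′ F ∘ Equivalence.to D≈F′)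

lemma5p6 : (n : ℕ) (G : Graph n) → CyclicallyOrientable G →
    (j : Fin n) → ∃[ k ] T (adj G j k) →
    ∃[ k ] (T (adj G j k) ×
      (∀ (C D : ChordlessCycle G) → EdgeOf C j k → EdgeOf D j k → SameCycle C D))
lemma5p6 n G (O , cyclic) j (_ , j~k₀) =
  let k , j~k , unique = neighbour-with-one-partner j~k₀ in k , j~k , one-cycle-through unique
  where
  open Oriented G O cyclic
  open Partners j
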